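{- Let $q$ be a prime power, $n_1,n_2$ positive integers coprime to $q$, $\gamma_1\in\mathbb{Z}/n_1\mathbb{Z}$, $\gamma_2\in\mathbb{Z}/n_2\mathbb{Z}$. Then $M_{c_{n_1/q}(\gamma_1)}(X)=M_{c_{n_2/q}(\gamma_2)}(X)$ if and only if $c_{n_1/q}(\gamma_1)$ and $c_{n_2/q}(\gamma_2)$ have the same primitive form.
   Context: For $m$ coprime to $q$ and $\beta\in\mathbb{Z}/m\mathbb{Z}$, $c_{m/q}(\beta)=\{\beta,\beta q,\dots,\beta q^{\tau-1}\}\subseteq\mathbb{Z}/m\mathbb{Z}$ with $\tau$ least positive such that $\beta q^\tau\equiv\beta\pmod m$. Fix in an algebraic closure of $\mathbb{F}_q$ a compatible family $\{\zeta_m:\gcd(m,q)=1\}$ of primitive $m$-th roots of unity ($\zeta_n^{n/m}=\zeta_m$ whenever $m\mid n$), and set $M_{c_{m/q}(\beta)}(X)=\prod_{j=0}^{\tau-1}(X-\zeta_m^{\beta q^j})$. The primitive form of $c_{m/q}(\beta)$ is the coset $c_{m_\beta/q}(\widetilde\beta)$ where $m_\beta=m/\gcd(\beta,m)$ and $\widetilde\beta=\beta/\gcd(\beta,m)$ (independent of the representative); two primitive forms are the same if they have the same modulus and are equal as subsets. -}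

module Defs where

open import Level using (Level; _⊔_)
open import Data.Nat as ℕ using (ℕ; zero; suc; _≤_; _<_)
open import Data.Nat.Primality using (Prime)
open import Data.Nat.GCD using (gcd)
open import Data.Nat.Coprimality using (Coprime)
open import Data.Integer as ℤ using (ℤ; +_)
open import Data.Integer.Divisibility as ℤD using ()
open import Data.List using (List; []; _∷_; _++_; [_]; length; map)
open import Data.List.Relation.Unary.All using (All)
open import Data.List.Relation.Binary.Pointwise using (Pointwise)
open import Data.Product using (Σ; ∃; ∃-syntax; _×_; _,_)
open import Relation.Nullary using (¬_)
open import Relation.Binary.PropositionalEquality using (_≡_)
open import Function.Bundles using (_⇔_)
open import Algebra.Bundles using (CommutativeRing)
import Algebra.Bundles
import Algebra.Definitions.RawSemiring as RS

IsPrimePower : ℕ → Set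
IsPrimePower q = ∃[ p ] ∃[ k ] (Prime p × 1 ≤ k × q ≡ p ℕ.^ k)

-- a ≡ b (mod m), via divisibility in ℤ (meaningful for every m)
infix 4 _≡_[mod_]
_≡_[mod_] : ℕ → ℕ → ℕ → Set
a ≡ b [mod m ] = (+ m) ℤD.∣ ((+ a) ℤ.- (+ b))

IsCosetSize : (m q β τ : ℕ) → Set
IsCosetSize m q β τ =
  1 ≤ τ × (β ℕ.* q ℕ.^ τ ≡ β [mod m ]) ×
  (∀ t → 1 ≤ t → t < τ → ¬ (β ℕ.* q ℕ.^ t ≡ β [mod m ]))

-- the q-cyclotomic coset c_{m/q}(β) as a subset of ℤ/mℤ = {0,…,m-1}
InCoset : (m q β : ℕ) → ℕ → Set
InCoset m q β x = x < m × ∃[ j ] (x ≡ β ℕ.* q ℕ.^ j [mod m ])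

IsPrimitiveForm : (m β m' β' : ℕ) → Set
IsPrimitiveForm m β m' β' = m ≡ m' ℕ.* gcd β m × β ≡ β' ℕ.* gcd β m

SamePrimitiveForm : (q n₁ γ₁ n₂ γ₂ : ℕ) → Set
SamePrimitiveForm q n₁ γ₁ n₂ γ₂ =
  ∃[ m ] ∃[ β₁ ] ∃[ β₂ ]
    (IsPrimitiveForm n₁ γ₁ m β₁ × IsPrimitiveForm n₂ γ₂ m β₂ ×
     (∀ x → InCoset m q β₁ x ⇔ InCoset m q β₂ x))

module _ {c ℓ : Level} (F : CommutativeRing c ℓ) where
  open CommutativeRing F
  open RS (Algebra.Bundles.Semiring.rawSemiring semiring) using (_^_; _×′_) renaming (_×_ to _·ₙ_)

  -- polynomials as coefficient lists, lowest degree first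
  Poly : Set c
  Poly = List Carrier

  addP : Poly → Poly → Poly
  addP [] g = g
  addP f [] = f
  addP (a ∷ f) (b ∷ g) = (a + b) ∷ addP f g

  mulXminus : Carrier → Poly → Poly
  mulXminus a f = addP (0# ∷ f) (map (λ b → (- a) * b) f)

  eval : Poly → Carrier → Carrier
  eval [] x = 0#
  eval (a ∷ f) x = a + x * eval f x

  -- equality of polynomials (coefficientwise; used for monic polynomials
  -- written without trailing zeros)
  PolyEq : Poly → Poly → Set (c ⊔ ℓ)
  PolyEq = Pointwise _≈_

  IsField : Set (c ⊔ ℓ)
  IsField = ¬ (1# ≈ 0#) × (∀ x → ¬ (x ≈ 0#) → ∃[ y ] (x * y ≈ 1#))

  IsAlgebraicallyClosed : Set (c ⊔ ℓ)
  IsAlgebraicallyClosed =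
    ∀ (cs : List Carrier) (a : Carrier) → ¬ (a ≈ 0#) → 1 ≤ length cs →
    ∃[ x ] (eval (cs ++ [ a ]) x ≈ 0#)

  -- F is an algebraic closure of F_q (q a prime power p^k):
  -- a field of characteristic p, algebraically closed, and algebraic over
  -- its subfield F_q = {a | a^q = a}
  IsAlgebraicClosureOfFq : ℕ → Set (c ⊔ ℓ)
  IsAlgebraicClosureOfFq q =
    IsField × IsAlgebraicallyClosed ×
    (∃[ p ] ∃[ k ] (Prime p × 1 ≤ k × q ≡ p ℕ.^ k × (p ·ₙ 1#) ≈ 0#)) ×
    (∀ x → ∃[ cs ] (All (λ a → a ^ q ≈ a) cs × eval (cs ++ [ 1# ]) x ≈ 0#))

  IsPrimitiveRoot : ℕ → Carrier → Set ℓ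
  IsPrimitiveRoot m z = z ^ m ≈ 1# × (∀ d → 1 ≤ d → d < m → ¬ (z ^ d ≈ 1#))

  IsCompatibleFamily : ℕ → (ℕ → Carrier) → Set ℓ
  IsCompatibleFamily q ζ =
    (∀ m → 1 ≤ m → Coprime m q → IsPrimitiveRoot m (ζ m)) ×
    (∀ m k → 1 ≤ m → 1 ≤ k → Coprime (k ℕ.* m) q →
       ζ (k ℕ.* m) ^ k ≈ ζ m)

  minPolyUpTo : (q : ℕ) (ζ : ℕ → Carrier) (m β t : ℕ) → Poly
  minPolyUpTo q ζ m β zero = [ 1# ]
  minPolyUpTo q ζ m β (suc t) =
    mulXminus (ζ m ^ (β ℕ.* q ℕ.^ t)) (minPolyUpTo q ζ m β t)

  -- M_{c_{m/q}(β)}(X), where τ is the size of the coset (see IsCosetSize)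
  M : (q : ℕ) (ζ : ℕ → Carrier) (m β τ : ℕ) → Poly
  M = minPolyUpTo

-- Write n = m g and γ = β g with g = gcd(γ, n), so that gcd(β, m) = 1. Compatibility of the
-- family gives ζ_n^(γ q^j) = ζ_m^(β q^j), and γ q^t ≡ γ (mod n) iff q^t ≡ 1 (mod m); hence
-- M_{c_{n/q}(γ)} is the product of X - ζ_m^(β q^j) over one period j < ord_m(q) of a periodic
-- sequence. If the primitive forms agree, β₂ ≡ β₁ q^s (mod m), so the two products run over
-- shifts of the same period and coincide. Conversely, in a field ζ_{n₁}^γ₁ is a root of
-- M_{c_{n₂/q}(γ₂)}, so ζ_{m₁}^β₁ = ζ_{m₂}^(β₂ q^j) for some j; both exponents are units, so
-- comparing orders gives m₁ = m₂, then β₁ ≡ β₂ q^j (mod m₁), and the two cosets are equal.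

{-# OPTIONS --safe #-}
module Submission where

open import Defs
open import Level using (_⊔_)
open import Algebra.Bundles using (CommutativeRing)
open import Data.List using ([]; _∷_; [_]; map)
import Data.List.Relation.Binary.Pointwise as Pointwise
open import Data.List.Relation.Binary.Pointwise using ([]; _∷_)
open import Data.Maybe using (nothing)
open import Data.Nat.Base as ℕ
  using (ℕ; zero; suc; _≤_; _<_; s≤s; z≤n; NonZero; >-nonZero; >-nonZero⁻¹)
open import Data.Nat.Properties as ℕ
  using ( _≟_; +-suc; ≤-refl; m<n⇒m<1+n; ≤-total; m+[n∸m]≡n; m∸n≤m; ≤-<-trans; <⇒≤
        ; ≤-antisym; m∸n≡0⇒m≤n; m^n≢0; anyUpTo?)
open import Data.Nat.DivMod using (_%_; _/_; m≡m%n+[m/n]*n; m%n<n; m<n⇒m%n≡m)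
open import Data.Nat.Divisibility using (_∣_; m%n≡0⇒n∣m; ∣-antisym)
open import Data.Nat.GCD using (gcd)
open import Data.Nat.Coprimality using (Coprime; coprime-divisor)
import Data.Nat.Coprimality as Coprime
open import Data.Nat.Primality using (prime⇒nonZero)
open import Data.Product as Product using (∃₂; ∃-syntax; _×_; _,_; proj₁; proj₂)
open import Data.Sum using (inj₁; inj₂)
open import Function using (_∘_)
open import Function.Bundles using (_⇔_; mk⇔; Equivalence)
open import Function.Construct.Composition using (_⇔-∘_)
open import Function.Construct.Symmetry using (⇔-sym)
open import Relation.Binary.Bundles using (Setoid)
open import Relation.Binary.PropositionalEquality as ≡ using (_≡_)
open import Relation.Nullary using (¬_; Dec; contradiction)
open import Relation.Nullary.Decidable using (_×-dec_; decidable-stable)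
open import Tactic.RingSolver using (solve-∀)
open import Tactic.RingSolver.Core.AlmostCommutativeRing
  using (AlmostCommutativeRing; fromCommutativeRing)
import Algebra.Properties.Ring as RingProperties
import Algebra.Properties.CommutativeSemigroup as CommutativeSemigroupProperties
import Algebra.Properties.Semiring.Exp as Exp
import Relation.Binary.Reasoning.Setoid as SetoidReasoning

module CyclotomicCosets where

  open import Data.Nat.Base using (_+_; _*_; _∸_; _^_; ≢-nonZero; ≢-nonZero⁻¹)
  open import Data.Nat.Properties
  open import Data.Nat.DivMod
  open import Data.Nat.Divisibility using (n∣m*n; m∣m*n; ∣n⇒∣m*n; ∣-trans; *-cancelʳ-∣; *-monoˡ-∣)
  open import Data.Nat.GCD using (gcd[m,n]∣m; gcd[m,n]∣n; gcd[m,n]≢0)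
  open import Data.Nat.Coprimality using (coprime-/gcd; 1-coprimeTo)
  open import Data.Integer.Base as ℤ using (+_; _⊖_)
  open import Data.Integer.Properties using (m-n≡m⊖n; ⊖-≥; ∣m⊖n∣≡∣n⊖m∣)
  open import Algebra.Properties.CommutativeSemigroup *-commutativeSemigroup using (xy∙z≈xz∙y)
  import Function.Related.Propositional as Related
  open import Relation.Binary.PropositionalEquality
  open import Relation.Binary.Definitions using (tri<; tri≈; tri>)

  private
    variable
      a b d j k m n q x m₁ m₂ β₁ β₂ τ τ₁ τ₂ : ℕ

  ≡[mod]-sym : a ≡ b [mod m ] → b ≡ a [mod m ]
  ≡[mod]-sym {a} {b} {m} = subst (m ∣_) ∣a-b∣≡∣b-a∣
    where
    open ≡-Reasoning
    ∣a-b∣≡∣b-a∣ : ℤ.∣ + a ℤ.- + b ∣ ≡ ℤ.∣ + b ℤ.- + a ∣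
    ∣a-b∣≡∣b-a∣ = begin
      ℤ.∣ + a ℤ.- + b ∣ ≡⟨ cong ℤ.∣_∣ (m-n≡m⊖n a b) ⟩
      ℤ.∣ a ⊖ b ∣       ≡⟨ ∣m⊖n∣≡∣n⊖m∣ a b ⟩
      ℤ.∣ b ⊖ a ∣       ≡⟨ cong ℤ.∣_∣ (m-n≡m⊖n b a) ⟨
      ℤ.∣ + b ℤ.- + a ∣ ∎

  ≡[mod]⇔∣∸ : b ≤ a → a ≡ b [mod m ] ⇔ m ∣ a ∸ b
  ≡[mod]⇔∣∸ {b} {a} {m} b≤a = mk⇔ (subst (m ∣_) ∣a-b∣≡a∸b) (subst (m ∣_) (sym ∣a-b∣≡a∸b))
    where
    ∣a-b∣≡a∸b : ℤ.∣ + a ℤ.- + b ∣ ≡ a ∸ b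
    ∣a-b∣≡a∸b = cong ℤ.∣_∣ (trans (m-n≡m⊖n a b) (⊖-≥ b≤a))

  module _ .{{_ : NonZero m}} where

    %≡⇒∣∸ : a % m ≡ b % m → m ∣ a ∸ b
    %≡⇒∣∸ {a} {b} a%m≡b%m = subst (m ∣_) (sym a∸b≡[a/m∸b/m]*m) (n∣m*n (a / m ∸ b / m))
      where
      open ≡-Reasoning
      a∸b≡[a/m∸b/m]*m : a ∸ b ≡ (a / m ∸ b / m) * m
      a∸b≡[a/m∸b/m]*m = begin
        a ∸ b
          ≡⟨ cong₂ _∸_ (m≡m%n+[m/n]*n a m) (m≡m%n+[m/n]*n b m) ⟩
        (a % m + a / m * m) ∸ (b % m + b / m * m)
          ≡⟨ cong (λ r → (a % m + a / m * m) ∸ (r + b / m * m)) a%m≡b%m ⟨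
        (a % m + a / m * m) ∸ (a % m + b / m * m)
          ≡⟨ [m+n]∸[m+o]≡n∸o (a % m) _ _ ⟩
        a / m * m ∸ b / m * m
          ≡⟨ *-distribʳ-∸ m (a / m) (b / m) ⟨
        (a / m ∸ b / m) * m
          ∎

    ∣∸⇒%≡ : b ≤ a → m ∣ a ∸ b → a % m ≡ b % m
    ∣∸⇒%≡ {b} {a} b≤a m∣a∸b = trans (%-congˡ (sym (m+[n∸m]≡n b≤a))) (%-remove-+ʳ b m∣a∸b)

    ∣∸⇔%≡ : b ≤ a → m ∣ a ∸ b ⇔ a % m ≡ b % m
    ∣∸⇔%≡ b≤a = mk⇔ (∣∸⇒%≡ b≤a) %≡⇒∣∸

    ≡[mod]⇔%≡ : a ≡ b [mod m ] ⇔ a % m ≡ b % m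
    ≡[mod]⇔%≡ {a} {b} with ≤-total b a
    ... | inj₁ b≤a = ∣∸⇔%≡ b≤a ⇔-∘ ≡[mod]⇔∣∸ b≤a
    ... | inj₂ a≤b = begin
      a ≡ b [mod m ] ∼⟨ mk⇔ (≡[mod]-sym {a} {b}) (≡[mod]-sym {b} {a}) ⟩
      b ≡ a [mod m ] ∼⟨ ≡[mod]⇔∣∸ a≤b ⟩
      m ∣ b ∸ a      ∼⟨ ∣∸⇔%≡ a≤b ⟩
      b % m ≡ a % m  ∼⟨ mk⇔ sym sym ⟩
      a % m ≡ b % m  ∎
      where open Related.EquationalReasoning

    %≡-*-congʳ : ∀ c → a % m ≡ b % m → (a * c) % m ≡ (b * c) % m
    %≡-*-congʳ {a} {b} c a%m≡b%m = begin
      (a * c) % m           ≡⟨ %-distribˡ-* a c m ⟩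
      (a % m * (c % m)) % m ≡⟨ cong (λ r → (r * (c % m)) % m) a%m≡b%m ⟩
      (b % m * (c % m)) % m ≡⟨ %-distribˡ-* b c m ⟨
      (b * c) % m           ∎
      where open ≡-Reasoning

    %≡-*-congˡ : ∀ c → a % m ≡ b % m → (c * a) % m ≡ (c * b) % m
    %≡-*-congˡ {a} {b} c a%m≡b%m =
      subst₂ (λ x y → x % m ≡ y % m) (*-comm a c) (*-comm b c) (%≡-*-congʳ c a%m≡b%m)

    %≡-^-cong : ∀ k → a % m ≡ b % m → (a ^ k) % m ≡ (b ^ k) % m
    %≡-^-cong zero    a%m≡b%m = refl
    %≡-^-cong {a} {b} (suc k) a%m≡b%m = begin
      (a * a ^ k) % m           ≡⟨ %≡-*-congʳ (a ^ k) a%m≡b%m ⟩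
      (b * a ^ k) % m           ≡⟨ %-distribˡ-* b (a ^ k) m ⟩
      (b % m * (a ^ k % m)) % m ≡⟨ cong (λ r → (b % m * r) % m) (%≡-^-cong k a%m≡b%m) ⟩
      (b % m * (b ^ k % m)) % m ≡⟨ %-distribˡ-* b (b ^ k) m ⟨
      (b * b ^ k) % m           ∎
      where open ≡-Reasoning

  coprime-* : Coprime a m → Coprime b m → Coprime (a * b) m
  coprime-* {a} {m} a⊥m b⊥m (d∣ab , d∣m) = b⊥m (coprime-divisor d⊥a d∣ab , d∣m)
    where
    d⊥a : Coprime _ a
    d⊥a (e∣d , e∣a) = a⊥m (e∣a , ∣-trans e∣d d∣m)

  coprime-^ : ∀ k → Coprime a m → Coprime (a ^ k) m
  coprime-^ zero    a⊥m = 1-coprimeTo _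
  coprime-^ (suc k) a⊥m = coprime-* a⊥m (coprime-^ k a⊥m)

  ∣-coprime : m ∣ n → Coprime n k → Coprime m k
  ∣-coprime m∣n n⊥k (d∣m , d∣k) = n⊥k (∣-trans d∣m m∣n , d∣k)

  gcd-nonZeroʳ : ∀ a n .{{_ : NonZero n}} → NonZero (gcd a n)
  gcd-nonZeroʳ a n = ≢-nonZero (gcd[m,n]≢0 a n (inj₂ (≢-nonZero⁻¹ n)))

  primitiveForm : ∀ n γ .{{_ : NonZero n}} → ∃₂ (IsPrimitiveForm n γ)
  primitiveForm n γ =
    n / gcd γ n , γ / gcd γ n , sym (m/n*n≡m (gcd[m,n]∣n γ n)) , sym (m/n*n≡m (gcd[m,n]∣m γ n))
    where instance _ = gcd-nonZeroʳ γ n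

  module PrimitiveForm {n γ : ℕ} .{{n≢0 : NonZero n}} (m β : ℕ) (pf : IsPrimitiveForm n γ m β)
    where

    private
      g = gcd γ n
      n≡m*g = proj₁ pf
      γ≡β*g = proj₂ pf

    nonZero : NonZero m
    nonZero = m*n≢0⇒m≢0 m {{subst NonZero n≡m*g n≢0}}

    coprime : Coprime β m
    coprime = subst₂ Coprime (/g-cancel γ≡β*g) (/g-cancel n≡m*g) (coprime-/gcd γ n)
      where
      instance _ = gcd-nonZeroʳ γ n
      /g-cancel : ∀ {a b} → a ≡ b * g → a / g ≡ b
      /g-cancel {b = b} a≡b*g = trans (cong (_/ g) a≡b*g) (m*n/n≡m b g)

    ∣n : m ∣ n
    ∣n = subst (m ∣_) (sym n≡m*g) (m∣m*n g)

    coprimeTo : Coprime n k → Coprime m k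
    coprimeTo = ∣-coprime ∣n

    coprime-*q^ : Coprime m q → ∀ j → Coprime (β * q ^ j) m
    coprime-*q^ m⊥q j = coprime-* coprime (coprime-^ j (Coprime.sym m⊥q))

    ∣γ*⇔∣ : n ∣ γ * d ⇔ m ∣ d
    ∣γ*⇔∣ {d} = mk⇔
      (λ n∣γd → coprime-divisor (Coprime.sym coprime)
                  (*-cancelʳ-∣ g (subst₂ _∣_ n≡m*g γd≡βd*g n∣γd)))
      (λ m∣d → subst₂ _∣_ (sym n≡m*g) (sym γd≡βd*g) (*-monoˡ-∣ g (∣n⇒∣m*n β m∣d)))
      where
      instance _ = gcd-nonZeroʳ γ n
      γd≡βd*g : γ * d ≡ β * d * g
      γd≡βd*g = trans (cong (_* d) γ≡β*g) (xy∙z≈xz∙y β g d)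

    cosetCondition : .{{_ : NonZero m}} .{{_ : NonZero q}} →
      ∀ t → γ * q ^ t ≡ γ [mod n ] ⇔ q ^ t % m ≡ 1 % m
    cosetCondition {q = q} t = begin
      γ * q ^ t ≡ γ [mod n ] ∼⟨ ≡[mod]⇔∣∸ (m≤m*n γ (q ^ t) {{m^n≢0 q t}}) ⟩
      n ∣ γ * q ^ t ∸ γ      ≡⟨ cong (λ x → n ∣ γ * q ^ t ∸ x) (sym (*-identityʳ γ)) ⟩
      n ∣ γ * q ^ t ∸ γ * 1  ≡⟨ cong (n ∣_) (sym (*-distribˡ-∸ γ (q ^ t) 1)) ⟩
      n ∣ γ * (q ^ t ∸ 1)    ∼⟨ ∣γ*⇔∣ ⟩
      m ∣ q ^ t ∸ 1          ∼⟨ ∣∸⇔%≡ (m^n>0 q t) ⟩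
      q ^ t % m ≡ 1 % m      ∎
      where open Related.EquationalReasoning

  cosetSize-unique : (∀ t → β₁ * q ^ t ≡ β₁ [mod m₁ ] ⇔ β₂ * q ^ t ≡ β₂ [mod m₂ ]) →
    IsCosetSize m₁ q β₁ τ₁ → IsCosetSize m₂ q β₂ τ₂ → τ₁ ≡ τ₂
  cosetSize-unique {τ₁ = τ₁} {τ₂ = τ₂} same (1≤τ₁ , fix₁ , least₁) (1≤τ₂ , fix₂ , least₂)
    with <-cmp τ₁ τ₂
  ... | tri< τ₁<τ₂ _ _ = contradiction (Equivalence.to (same τ₁) fix₁) (least₂ τ₁ 1≤τ₁ τ₁<τ₂)
  ... | tri≈ _ τ₁≡τ₂ _ = τ₁≡τ₂
  ... | tri> _ _ τ₂<τ₁ = contradiction (Equivalence.from (same τ₂) fix₂) (least₁ τ₂ 1≤τ₂ τ₂<τ₁)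

  module _ .{{_ : NonZero m}} where

    InCoset-transport : β₁ % m ≡ (β₂ * q ^ j) % m → InCoset m q β₁ x → InCoset m q β₂ x
    InCoset-transport {β₁} {β₂} {q} {j} {x} β₁≡β₂qʲ (x<m , i , x≡β₁qⁱ) =
      x<m , j + i , Equivalence.from ≡[mod]⇔%≡ (begin
        x % m                      ≡⟨ Equivalence.to ≡[mod]⇔%≡ x≡β₁qⁱ ⟩
        (β₁ * q ^ i) % m           ≡⟨ %≡-*-congʳ (q ^ i) β₁≡β₂qʲ ⟩
        (β₂ * q ^ j * q ^ i) % m   ≡⟨ cong (_% m) (*-assoc β₂ (q ^ j) (q ^ i)) ⟩
        (β₂ * (q ^ j * q ^ i)) % m ≡⟨ cong (λ e → (β₂ * e) % m) (^-distribˡ-+-* q j i) ⟨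
        (β₂ * q ^ (j + i)) % m     ∎)
      where open ≡-Reasoning

    %≡-*q^-swap : q ^ suc τ % m ≡ 1 % m → β₁ % m ≡ (β₂ * q ^ j) % m →
      β₂ % m ≡ (β₁ * q ^ (τ * j)) % m
    %≡-*q^-swap {q} {τ} {β₁} {β₂} {j} qᵗ≡1 β₁≡β₂qʲ = sym (begin
      (β₁ * q ^ (τ * j)) % m
        ≡⟨ %≡-*-congʳ (q ^ (τ * j)) β₁≡β₂qʲ ⟩
      (β₂ * q ^ j * q ^ (τ * j)) % m
        ≡⟨ cong (_% m) (*-assoc β₂ (q ^ j) (q ^ (τ * j))) ⟩
      (β₂ * (q ^ j * q ^ (τ * j))) % m
        ≡⟨ cong (λ e → (β₂ * e) % m) (^-distribˡ-+-* q j (τ * j)) ⟨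
      (β₂ * q ^ (suc τ * j)) % m
        ≡⟨ cong (λ e → (β₂ * e) % m) (^-*-assoc q (suc τ) j) ⟨
      (β₂ * (q ^ suc τ) ^ j) % m
        ≡⟨ %≡-*-congˡ β₂ (%≡-^-cong j qᵗ≡1) ⟩
      (β₂ * 1 ^ j) % m
        ≡⟨ cong (λ e → (β₂ * e) % m) (^-zeroˡ j) ⟩
      (β₂ * 1) % m
        ≡⟨ cong (_% m) (*-identityʳ β₂) ⟩
      β₂ % m
        ∎)
      where open ≡-Reasoning

    InCoset-⇔ : 1 ≤ τ → q ^ τ % m ≡ 1 % m → β₁ % m ≡ (β₂ * q ^ j) % m →
      ∀ x → InCoset m q β₁ x ⇔ InCoset m q β₂ x
    InCoset-⇔ {τ = suc τ} {q = q} {β₁ = β₁} {β₂ = β₂} {j = j} _ qᵗ≡1 β₁≡β₂qʲ x = mk⇔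
      (InCoset-transport {β₁ = β₁} {β₂ = β₂} {q = q} {j = j} β₁≡β₂qʲ)
      (InCoset-transport {β₁ = β₂} {β₂ = β₁} {q = q} {j = τ * j}
        (%≡-*q^-swap {q = q} {τ = τ} {β₁ = β₁} {β₂ = β₂} {j = j} qᵗ≡1 β₁≡β₂qʲ))

    InCoset-⊆⇒q-power : (∀ x → InCoset m q β₂ x → InCoset m q β₁ x) →
      ∃[ s ] β₂ % m ≡ (β₁ * q ^ s) % m
    InCoset-⊆⇒q-power {q} {β₂} {β₁} β₂⊆β₁ with β₂⊆β₁ (β₂ % m) β₂%m∈β₂
      where
      β₂%m∈β₂ : InCoset m q β₂ (β₂ % m)
      β₂%m∈β₂ = m%n<n β₂ m , 0 , Equivalence.from ≡[mod]⇔%≡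
        (trans (m%n%n≡m%n β₂ m) (cong (_% m) (sym (*-identityʳ β₂))))
    ... | _ , s , β₂%m≡β₁qˢ =
      s , trans (sym (m%n%n≡m%n β₂ m)) (Equivalence.to ≡[mod]⇔%≡ β₂%m≡β₁qˢ)

open CyclotomicCosets

module Polynomials {c ℓ} (F : CommutativeRing c ℓ) where

  private
    ring′ : AlmostCommutativeRing c ℓ
    ring′ = fromCommutativeRing F (λ _ → nothing)

    horner : let open AlmostCommutativeRing ring′ in
      ∀ b u z x e → (b + u * z) + x * (z + (x + u) * e) ≈ b + (x + u) * (z + x * e)
    horner = solve-∀ ring′

  open CommutativeRing F
  open RingProperties ring using (x∙y⁻¹≈ε⇒x≈y)
  open CommutativeSemigroupProperties +-commutativeSemigroup using (xy∙z≈xz∙y)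
  open CommutativeSemigroupProperties *-commutativeSemigroup using (x∙yz≈y∙xz)
  open SetoidReasoning setoid

  polySetoid : Setoid c (c ⊔ ℓ)
  polySetoid = Pointwise.setoid setoid

  open Setoid polySetoid public using ()
    renaming (_≈_ to _≈ₚ_; refl to ≈ₚ-refl; sym to ≈ₚ-sym; trans to ≈ₚ-trans)

  -- mulXminusAdd a b f = b + (X - a) * f and mulXminus F a = mulXminusAdd a 0#; the extra
  -- constant b is what makes commutation of two factors provable by induction on f.
  mulXminusAdd : Carrier → Carrier → Poly F → Poly F
  mulXminusAdd a b f = addP F (b ∷ f) (map (λ z → (- a) * z) f)

  mulXminusAdd-cong : ∀ {a a′ b b′ f f′} → a ≈ a′ → b ≈ b′ → f ≈ₚ f′ →
    mulXminusAdd a b f ≈ₚ mulXminusAdd a′ b′ f′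
  mulXminusAdd-cong a≈a′ b≈b′ []            = b≈b′ ∷ []
  mulXminusAdd-cong a≈a′ b≈b′ (z≈z′ ∷ f≈f′) =
    +-cong b≈b′ (*-cong (-‿cong a≈a′) z≈z′) ∷ mulXminusAdd-cong a≈a′ z≈z′ f≈f′

  mulXminusAdd-comm : ∀ a c f {x x′ y} → x + - a * y ≈ x′ + - c * y →
    mulXminusAdd a x (mulXminusAdd c y f) ≈ₚ mulXminusAdd c x′ (mulXminusAdd a y f)
  mulXminusAdd-comm a c []      eq = eq ∷ refl ∷ []
  mulXminusAdd-comm a c (z ∷ f) {x} {x′} {y} eq =
    head ∷ mulXminusAdd-comm a c f (xy∙z≈xz∙y y (- c * z) (- a * z))
    where
    expand : ∀ x u y v → x + u * (y + v * z) ≈ (x + u * y) + u * (v * z)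
    expand x u y v =
      trans (+-congˡ (distribˡ u y (v * z))) (sym (+-assoc x (u * y) (u * (v * z))))
    head : x + - a * (y + - c * z) ≈ x′ + - c * (y + - a * z)
    head = begin
      x + - a * (y + - c * z)          ≈⟨ expand x (- a) y (- c) ⟩
      (x + - a * y) + - a * (- c * z)  ≈⟨ +-cong eq (x∙yz≈y∙xz (- a) (- c) z) ⟩
      (x′ + - c * y) + - c * (- a * z) ≈⟨ expand x′ (- c) y (- a) ⟨
      x′ + - c * (y + - a * z)         ∎

  mulXminus-cong : ∀ {a a′ f f′} → a ≈ a′ → f ≈ₚ f′ → mulXminus F a f ≈ₚ mulXminus F a′ f′
  mulXminus-cong a≈a′ = mulXminusAdd-cong a≈a′ refl

  mulXminus-comm : ∀ a c f →
    mulXminus F a (mulXminus F c f) ≈ₚ mulXminus F c (mulXminus F a f)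
  mulXminus-comm a c f =
    mulXminusAdd-comm a c f (+-congˡ (trans (zeroʳ (- a)) (sym (zeroʳ (- c)))))

  eval-cong : ∀ {f g} x → f ≈ₚ g → eval F f x ≈ eval F g x
  eval-cong x []          = refl
  eval-cong x (a≈b ∷ f≈g) = +-cong a≈b (*-congˡ (eval-cong x f≈g))

  eval-mulXminusAdd : ∀ a b f x → eval F (mulXminusAdd a b f) x ≈ b + (x + - a) * eval F f x
  eval-mulXminusAdd a b []      x = +-congˡ (trans (zeroʳ x) (sym (zeroʳ (x + - a))))
  eval-mulXminusAdd a b (z ∷ f) x = begin
    (b + - a * z) + x * eval F (mulXminusAdd a z f) x
      ≈⟨ +-congˡ (*-congˡ (eval-mulXminusAdd a z f x)) ⟩
    (b + - a * z) + x * (z + (x + - a) * eval F f x)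
      ≈⟨ horner b (- a) z x (eval F f x) ⟩
    b + (x + - a) * (z + x * eval F f x)
      ∎

  eval-mulXminus : ∀ a f x → eval F (mulXminus F a f) x ≈ (x + - a) * eval F f x
  eval-mulXminus a f x = trans (eval-mulXminusAdd a 0# f x) (+-identityˡ _)

  prodXminus : (ℕ → Carrier) → ℕ → Poly F
  prodXminus b zero    = [ 1# ]
  prodXminus b (suc t) = mulXminus F (b t) (prodXminus b t)

  prodXminus-cong : ∀ {b b′} t → (∀ j → b j ≈ b′ j) → prodXminus b t ≈ₚ prodXminus b′ t
  prodXminus-cong zero    b≈b′ = ≈ₚ-refl
  prodXminus-cong (suc t) b≈b′ = mulXminus-cong (b≈b′ t) (prodXminus-cong t b≈b′)

  prodXminus-unconsˡ : ∀ b t →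
    prodXminus b (suc t) ≈ₚ mulXminus F (b 0) (prodXminus (b ∘ suc) t)
  prodXminus-unconsˡ b zero    = ≈ₚ-refl
  prodXminus-unconsˡ b (suc t) = ≈ₚ-trans
    (mulXminus-cong refl (prodXminus-unconsˡ b t))
    (mulXminus-comm (b (suc t)) (b 0) (prodXminus (b ∘ suc) t))

  prodXminus-rotate₁ : ∀ b t → b t ≈ b 0 → prodXminus (b ∘ suc) t ≈ₚ prodXminus b t
  prodXminus-rotate₁ b zero    _     = ≈ₚ-refl
  prodXminus-rotate₁ b (suc t) bₜ≈b₀ = ≈ₚ-trans
    (mulXminus-cong {f = prodXminus (b ∘ suc) t} bₜ≈b₀ ≈ₚ-refl)
    (≈ₚ-sym (prodXminus-unconsˡ b t))

  prodXminus-rotate : ∀ b t → (∀ i → b (i ℕ.+ t) ≈ b i) →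
    ∀ s → prodXminus (λ i → b (s ℕ.+ i)) t ≈ₚ prodXminus b t
  prodXminus-rotate b t periodic zero    = ≈ₚ-refl
  prodXminus-rotate b t periodic (suc s) = ≈ₚ-trans
    (prodXminus-cong t (λ i → reflexive (≡.cong b (≡.sym (+-suc s i)))))
    (≈ₚ-trans
      (prodXminus-rotate₁ (λ i → b (s ℕ.+ i)) t
        (trans (periodic s) (reflexive (≡.cong b (≡.sym (ℕ.+-identityʳ s))))))
      (prodXminus-rotate b t periodic s))

  prodXminus-root : ∀ b t → 1 ≤ t → eval F (prodXminus b t) (b 0) ≈ 0#
  prodXminus-root b (suc t) _ = begin
    eval F (prodXminus b (suc t)) (b 0)
      ≈⟨ eval-cong (b 0) (prodXminus-unconsˡ b t) ⟩
    eval F (mulXminus F (b 0) (prodXminus (b ∘ suc) t)) (b 0)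
      ≈⟨ eval-mulXminus (b 0) (prodXminus (b ∘ suc) t) (b 0) ⟩
    (b 0 + - b 0) * eval F (prodXminus (b ∘ suc) t) (b 0)
      ≈⟨ *-congʳ (-‿inverseʳ (b 0)) ⟩
    0# * eval F (prodXminus (b ∘ suc) t) (b 0)
      ≈⟨ zeroˡ _ ⟩
    0#
      ∎

  module _ (isField : IsField F) where

    IsField⇒*≉0 : ∀ {x y} → ¬ x ≈ 0# → ¬ y ≈ 0# → ¬ x * y ≈ 0#
    IsField⇒*≉0 {x} {y} x≉0 y≉0 xy≈0 with proj₂ isField x x≉0
    ... | x⁻¹ , xx⁻¹≈1 = y≉0 (begin
      y             ≈⟨ *-identityˡ y ⟨
      1# * y        ≈⟨ *-congʳ (trans (sym xx⁻¹≈1) (*-comm x x⁻¹)) ⟩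
      x⁻¹ * x * y   ≈⟨ *-assoc x⁻¹ x y ⟩
      x⁻¹ * (x * y) ≈⟨ *-congˡ xy≈0 ⟩
      x⁻¹ * 0#      ≈⟨ zeroʳ x⁻¹ ⟩
      0#            ∎)

    prodXminus-nonroot : ∀ b t x → (∀ j → j < t → ¬ x ≈ b j) →
      ¬ eval F (prodXminus b t) x ≈ 0#
    prodXminus-nonroot b zero    x _ =
      proj₁ isField ∘ trans (sym (trans (+-congˡ (zeroʳ x)) (+-identityʳ 1#)))
    prodXminus-nonroot b (suc t) x x≉bⱼ =
      IsField⇒*≉0 (x≉bₜ ∘ x∙y⁻¹≈ε⇒x≈y x (b t))
                  (prodXminus-nonroot b t x (λ j j<t → x≉bⱼ j (m<n⇒m<1+n j<t)))
      ∘ trans (sym (eval-mulXminus (b t) (prodXminus b t) x))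
      where x≉bₜ = x≉bⱼ t ≤-refl

module RootsOfUnity {c ℓ} (F : CommutativeRing c ℓ) where

  open CommutativeRing F
  open Exp semiring using (_^_; ^-congˡ; ^-congʳ; ^-homo-*; ^-assocʳ)
  open SetoidReasoning setoid

  module _ {m} .{{_ : NonZero m}} {z} (zᵐ≈1 : z ^ m ≈ 1#) where

    ^[j*m]≈1 : ∀ j → z ^ (j ℕ.* m) ≈ 1#
    ^[j*m]≈1 zero    = refl
    ^[j*m]≈1 (suc j) = begin
      z ^ (m ℕ.+ j ℕ.* m)   ≈⟨ ^-homo-* z m (j ℕ.* m) ⟩
      z ^ m * z ^ (j ℕ.* m) ≈⟨ *-cong zᵐ≈1 (^[j*m]≈1 j) ⟩
      1# * 1#               ≈⟨ *-identityˡ 1# ⟩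
      1#                    ∎

    ^-^m≈1 : ∀ a → (z ^ a) ^ m ≈ 1#
    ^-^m≈1 a = trans (^-assocʳ z a m) (^[j*m]≈1 a)

    ^-% : ∀ k → z ^ k ≈ z ^ (k % m)
    ^-% k = begin
      z ^ k                           ≈⟨ ^-congʳ z (m≡m%n+[m/n]*n k m) ⟩
      z ^ (k % m ℕ.+ k / m ℕ.* m)     ≈⟨ ^-homo-* z (k % m) (k / m ℕ.* m) ⟩
      z ^ (k % m) * z ^ (k / m ℕ.* m) ≈⟨ *-congˡ (^[j*m]≈1 (k / m)) ⟩
      z ^ (k % m) * 1#                ≈⟨ *-identityʳ _ ⟩
      z ^ (k % m)                     ∎

    ^-cancelˡ : ∀ {r u v} → r ≤ m → z ^ r * u ≈ z ^ r * v → u ≈ v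
    ^-cancelˡ {r} {u} {v} r≤m zʳu≈zʳv = begin
      u                           ≈⟨ *-identityˡ u ⟨
      1# * u                      ≈⟨ *-congʳ zᵐ⁻ʳzʳ≈1 ⟨
      z ^ (m ℕ.∸ r) * z ^ r * u   ≈⟨ *-assoc _ _ u ⟩
      z ^ (m ℕ.∸ r) * (z ^ r * u) ≈⟨ *-congˡ zʳu≈zʳv ⟩
      z ^ (m ℕ.∸ r) * (z ^ r * v) ≈⟨ *-assoc _ _ v ⟨
      z ^ (m ℕ.∸ r) * z ^ r * v   ≈⟨ *-congʳ zᵐ⁻ʳzʳ≈1 ⟩
      1# * v                      ≈⟨ *-identityˡ v ⟩
      v                           ∎
      where
      zᵐ⁻ʳzʳ≈1 : z ^ (m ℕ.∸ r) * z ^ r ≈ 1#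
      zᵐ⁻ʳzʳ≈1 = trans (sym (^-homo-* z (m ℕ.∸ r) r)) (trans (^-congʳ z (ℕ.m∸n+n≡m r≤m)) zᵐ≈1)

  module _ {m} .{{_ : NonZero m}} {z} (isPrimitive : IsPrimitiveRoot F m z) where

    private
      zᵐ≈1 = proj₁ isPrimitive

    ^≈1⇒≡0 : ∀ {d} → d < m → z ^ d ≈ 1# → d ≡ 0
    ^≈1⇒≡0 {zero}  _   _    = ≡.refl
    ^≈1⇒≡0 {suc d} d<m zᵈ≈1 = contradiction zᵈ≈1 (proj₂ isPrimitive (suc d) (s≤s z≤n) d<m)

    ^-injective-< : ∀ {r s} → r ≤ s → s < m → z ^ r ≈ z ^ s → r ≡ s
    ^-injective-< {r} {s} r≤s s<m zʳ≈zˢ = ≤-antisym r≤s (m∸n≡0⇒m≤n s∸r≡0)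
      where
      zʳ*1≈zʳ*zˢ⁻ʳ : z ^ r * 1# ≈ z ^ r * z ^ (s ℕ.∸ r)
      zʳ*1≈zʳ*zˢ⁻ʳ = begin
        z ^ r * 1#            ≈⟨ *-identityʳ _ ⟩
        z ^ r                 ≈⟨ zʳ≈zˢ ⟩
        z ^ s                 ≈⟨ ^-congʳ z (m+[n∸m]≡n r≤s) ⟨
        z ^ (r ℕ.+ (s ℕ.∸ r)) ≈⟨ ^-homo-* z r (s ℕ.∸ r) ⟩
        z ^ r * z ^ (s ℕ.∸ r) ∎
      s∸r≡0 : s ℕ.∸ r ≡ 0
      s∸r≡0 = ^≈1⇒≡0 (≤-<-trans (m∸n≤m s r) s<m)
        (sym (^-cancelˡ zᵐ≈1 (<⇒≤ (≤-<-trans r≤s s<m)) zʳ*1≈zʳ*zˢ⁻ʳ))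

    ^≈^⇔%≡ : ∀ {a b} → z ^ a ≈ z ^ b ⇔ a % m ≡ b % m
    ^≈^⇔%≡ {a} {b} = mk⇔ to from
      where
      to : z ^ a ≈ z ^ b → a % m ≡ b % m
      to zᵃ≈zᵇ with ≤-total (a % m) (b % m)
      ... | inj₁ a%m≤b%m = ^-injective-< a%m≤b%m (m%n<n b m) zᵃ⁰≈zᵇ⁰
        where zᵃ⁰≈zᵇ⁰ = trans (sym (^-% zᵐ≈1 a)) (trans zᵃ≈zᵇ (^-% zᵐ≈1 b))
      ... | inj₂ b%m≤a%m = ≡.sym (^-injective-< b%m≤a%m (m%n<n a m) zᵇ⁰≈zᵃ⁰)
        where zᵇ⁰≈zᵃ⁰ = trans (sym (^-% zᵐ≈1 b)) (trans (sym zᵃ≈zᵇ) (^-% zᵐ≈1 a))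
      from : a % m ≡ b % m → z ^ a ≈ z ^ b
      from a%m≡b%m = trans (^-% zᵐ≈1 a) (trans (^-congʳ z a%m≡b%m) (sym (^-% zᵐ≈1 b)))

    ^≈1⇒∣ : ∀ {k} → z ^ k ≈ 1# → m ∣ k
    ^≈1⇒∣ {k} zᵏ≈1 = m%n≡0⇒n∣m k m
      (≡.trans (Equivalence.to ^≈^⇔%≡ zᵏ≈1) (m<n⇒m%n≡m (>-nonZero⁻¹ m)))

    coprimePower-order-∣ : ∀ {a k w} → Coprime a m → w ^ k ≈ 1# → z ^ a ≈ w → m ∣ k
    coprimePower-order-∣ {a} {k} {w} a⊥m wᵏ≈1 zᵃ≈w =
      coprime-divisor (Coprime.sym a⊥m) (^≈1⇒∣ (begin
        z ^ (a ℕ.* k) ≈⟨ ^-assocʳ z a k ⟨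
        (z ^ a) ^ k   ≈⟨ ^-congˡ k zᵃ≈w ⟩
        w ^ k         ≈⟨ wᵏ≈1 ⟩
        1#            ∎))

module MinimalPolynomials {c ℓ} (F : CommutativeRing c ℓ) (q : ℕ) .{{_ : NonZero q}}
  (ζ : ℕ → CommutativeRing.Carrier F) (compatible : IsCompatibleFamily F q ζ) where

  open CommutativeRing F
  open Exp semiring using (_^_; ^-congˡ; ^-assocʳ)
  open Polynomials F
  open RootsOfUnity F

  conjugate : ℕ → ℕ → ℕ → Carrier
  conjugate m β j = ζ m ^ (β ℕ.* q ℕ.^ j)

  M≡prodXminus : ∀ m β t → M F q ζ m β t ≡ prodXminus (conjugate m β) t
  M≡prodXminus m β zero    = ≡.refl
  M≡prodXminus m β (suc t) = ≡.cong (mulXminus F (conjugate m β t)) (M≡prodXminus m β t)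

  ζ-primitive : ∀ m .{{_ : NonZero m}} → Coprime m q → IsPrimitiveRoot F m (ζ m)
  ζ-primitive m m⊥q = proj₁ compatible m (>-nonZero⁻¹ m) m⊥q

  ζ-^-compatible : ∀ g m k .{{_ : NonZero g}} .{{_ : NonZero m}} → Coprime (g ℕ.* m) q →
    ζ (g ℕ.* m) ^ (g ℕ.* k) ≈ ζ m ^ k
  ζ-^-compatible g m k gm⊥q = trans (sym (^-assocʳ (ζ (g ℕ.* m)) g k))
    (^-congˡ k (proj₂ compatible m g (>-nonZero⁻¹ m) (>-nonZero⁻¹ g) gm⊥q))

  ζ-unitPower-injective : ∀ {m₁ m₂ a₁ a₂} .{{_ : NonZero m₁}} .{{_ : NonZero m₂}} →
    Coprime m₁ q → Coprime m₂ q → Coprime a₁ m₁ → Coprime a₂ m₂ →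
    ζ m₁ ^ a₁ ≈ ζ m₂ ^ a₂ → m₁ ≡ m₂ × a₁ % m₁ ≡ a₂ % m₁
  ζ-unitPower-injective {m₁} {m₂} {a₁} {a₂} m₁⊥q m₂⊥q a₁⊥m₁ a₂⊥m₂ ζ₁ᵃ¹≈ζ₂ᵃ² =
    m₁≡m₂ , Equivalence.to (^≈^⇔%≡ ζ₁-primitive)
              (trans ζ₁ᵃ¹≈ζ₂ᵃ² (reflexive (≡.cong (λ m → ζ m ^ a₂) (≡.sym m₁≡m₂))))
    where
    ζ₁-primitive = ζ-primitive m₁ m₁⊥q
    ζ₂-primitive = ζ-primitive m₂ m₂⊥q
    m₁≡m₂ : m₁ ≡ m₂
    m₁≡m₂ = ∣-antisym
      (coprimePower-order-∣ ζ₁-primitive a₁⊥m₁ (^-^m≈1 (proj₁ ζ₂-primitive) a₂)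
        ζ₁ᵃ¹≈ζ₂ᵃ²)
      (coprimePower-order-∣ ζ₂-primitive a₂⊥m₂ (^-^m≈1 (proj₁ ζ₁-primitive) a₁)
        (sym ζ₁ᵃ¹≈ζ₂ᵃ²))

  module _ {n γ} .{{_ : NonZero n}} (n⊥q : Coprime n q) (m β : ℕ) (pf : IsPrimitiveForm n γ m β)
    where

    private
      g = gcd γ n
      instance _ = gcd-nonZeroʳ γ n
      instance _ = PrimitiveForm.nonZero m β pf
      n≡g*m : n ≡ g ℕ.* m
      n≡g*m = ≡.trans (proj₁ pf) (ℕ.*-comm m g)

    conjugate-primitiveForm : ∀ j → conjugate n γ j ≈ conjugate m β j
    conjugate-primitiveForm j = begin
      ζ n ^ (γ ℕ.* q ℕ.^ j)
        ≡⟨ ≡.cong₂ (λ n e → ζ n ^ e) n≡g*m γqʲ≡g*βqʲ ⟩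
      ζ (g ℕ.* m) ^ (g ℕ.* (β ℕ.* q ℕ.^ j))
        ≈⟨ ζ-^-compatible g m (β ℕ.* q ℕ.^ j) (≡.subst (λ n → Coprime n q) n≡g*m n⊥q) ⟩
      ζ m ^ (β ℕ.* q ℕ.^ j)
        ∎
      where
      open SetoidReasoning setoid
      open CommutativeSemigroupProperties ℕ.*-commutativeSemigroup using (xy∙z≈y∙xz)
      γqʲ≡g*βqʲ : γ ℕ.* q ℕ.^ j ≡ g ℕ.* (β ℕ.* q ℕ.^ j)
      γqʲ≡g*βqʲ = ≡.trans (≡.cong (ℕ._* q ℕ.^ j) (proj₂ pf)) (xy∙z≈y∙xz β g (q ℕ.^ j))

    M≈prodXminus-primitiveForm : ∀ t → M F q ζ n γ t ≈ₚ prodXminus (conjugate m β) t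
    M≈prodXminus-primitiveForm t =
      ≡.subst (_≈ₚ _) (≡.sym (M≡prodXminus n γ t)) (prodXminus-cong t conjugate-primitiveForm)

  module _ {m} .{{_ : NonZero m}} (m⊥q : Coprime m q) where

    open ≡.≡-Reasoning

    conjugate-shift : ∀ {β₁ β₂ s} → β₂ % m ≡ (β₁ ℕ.* q ℕ.^ s) % m →
      ∀ j → conjugate m β₂ j ≈ conjugate m β₁ (s ℕ.+ j)
    conjugate-shift {β₁} {β₂} {s} β₂≡β₁qˢ j =
      Equivalence.from (^≈^⇔%≡ (ζ-primitive m m⊥q)) (begin
      (β₂ ℕ.* q ℕ.^ j) % m
        ≡⟨ %≡-*-congʳ (q ℕ.^ j) β₂≡β₁qˢ ⟩
      (β₁ ℕ.* q ℕ.^ s ℕ.* q ℕ.^ j) % m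
        ≡⟨ ≡.cong (_% m) (ℕ.*-assoc β₁ (q ℕ.^ s) (q ℕ.^ j)) ⟩
      (β₁ ℕ.* (q ℕ.^ s ℕ.* q ℕ.^ j)) % m
        ≡⟨ ≡.cong (λ e → (β₁ ℕ.* e) % m) (ℕ.^-distribˡ-+-* q s j) ⟨
      (β₁ ℕ.* q ℕ.^ (s ℕ.+ j)) % m
        ∎)

    conjugate-periodic : ∀ {τ} → q ℕ.^ τ % m ≡ 1 % m →
      ∀ β i → conjugate m β (i ℕ.+ τ) ≈ conjugate m β i
    conjugate-periodic {τ} qᵗ≡1 β i =
      Equivalence.from (^≈^⇔%≡ (ζ-primitive m m⊥q)) (begin
      (β ℕ.* q ℕ.^ (i ℕ.+ τ)) % m
        ≡⟨ ≡.cong (λ e → (β ℕ.* e) % m) (ℕ.^-distribˡ-+-* q i τ) ⟩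
      (β ℕ.* (q ℕ.^ i ℕ.* q ℕ.^ τ)) % m
        ≡⟨ ≡.cong (_% m) (ℕ.*-assoc β (q ℕ.^ i) (q ℕ.^ τ)) ⟨
      (β ℕ.* q ℕ.^ i ℕ.* q ℕ.^ τ) % m
        ≡⟨ %≡-*-congˡ (β ℕ.* q ℕ.^ i) qᵗ≡1 ⟩
      (β ℕ.* q ℕ.^ i ℕ.* 1) % m
        ≡⟨ ≡.cong (_% m) (ℕ.*-identityʳ (β ℕ.* q ℕ.^ i)) ⟩
      (β ℕ.* q ℕ.^ i) % m
        ∎)

    prodXminus-conjugate-shift : ∀ τ β₁ β₂ → q ℕ.^ τ % m ≡ 1 % m →
      ∃[ s ] β₂ % m ≡ (β₁ ℕ.* q ℕ.^ s) % m →
      prodXminus (conjugate m β₂) τ ≈ₚ prodXminus (conjugate m β₁) τ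
    prodXminus-conjugate-shift τ β₁ β₂ qᵗ≡1 (s , β₂≡β₁qˢ) = ≈ₚ-trans
      (prodXminus-cong τ (conjugate-shift {β₁} {β₂} {s} β₂≡β₁qˢ))
      (prodXminus-rotate (conjugate m β₁) τ (conjugate-periodic qᵗ≡1 β₁) s)

  module _ {n₁ n₂ γ₁ γ₂ τ₁ τ₂} .{{_ : NonZero n₁}} .{{_ : NonZero n₂}}
    (n₁⊥q : Coprime n₁ q) (n₂⊥q : Coprime n₂ q)
    (size₁ : IsCosetSize n₁ q γ₁ τ₁) (size₂ : IsCosetSize n₂ q γ₂ τ₂) where

    samePrimitiveForm⇒M≈M : SamePrimitiveForm q n₁ γ₁ n₂ γ₂ →
      M F q ζ n₁ γ₁ τ₁ ≈ₚ M F q ζ n₂ γ₂ τ₂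
    samePrimitiveForm⇒M≈M (m , β₁ , β₂ , pf₁ , pf₂ , sameCoset) = begin
      M F q ζ n₁ γ₁ τ₁               ≈⟨ M≈prodXminus-primitiveForm n₁⊥q m β₁ pf₁ τ₁ ⟩
      prodXminus (conjugate m β₁) τ₁ ≡⟨ ≡.cong (prodXminus (conjugate m β₁)) τ₁≡τ₂ ⟩
      prodXminus (conjugate m β₁) τ₂ ≈⟨ conjugates₂≈conjugates₁ ⟨
      prodXminus (conjugate m β₂) τ₂ ≈⟨ M≈prodXminus-primitiveForm n₂⊥q m β₂ pf₂ τ₂ ⟨
      M F q ζ n₂ γ₂ τ₂               ∎
      where
      open SetoidReasoning polySetoid
      module P₁ = PrimitiveForm m β₁ pf₁
      module P₂ = PrimitiveForm m β₂ pf₂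
      instance _ = P₁.nonZero
      τ₁≡τ₂ : τ₁ ≡ τ₂
      τ₁≡τ₂ = cosetSize-unique {β₁ = γ₁} {q = q} {m₁ = n₁} {β₂ = γ₂} {m₂ = n₂}
        (λ t → ⇔-sym (P₂.cosetCondition t) ⇔-∘ P₁.cosetCondition t) size₁ size₂
      conjugates₂≈conjugates₁ : prodXminus (conjugate m β₂) τ₂ ≈ₚ prodXminus (conjugate m β₁) τ₂
      conjugates₂≈conjugates₁ = prodXminus-conjugate-shift (P₁.coprimeTo n₁⊥q) τ₂ β₁ β₂
        (Equivalence.to (P₂.cosetCondition τ₂) (proj₁ (proj₂ size₂)))
        (InCoset-⊆⇒q-power {q = q} {β₂ = β₂} {β₁ = β₁} (Equivalence.from ∘ sameCoset))

    M≈M⇒root : M F q ζ n₁ γ₁ τ₁ ≈ₚ M F q ζ n₂ γ₂ τ₂ →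
      eval F (prodXminus (conjugate n₂ γ₂) τ₂) (conjugate n₁ γ₁ 0) ≈ 0#
    M≈M⇒root M₁≈M₂ = begin
      eval F (prodXminus (conjugate n₂ γ₂) τ₂) r
        ≡⟨ ≡.cong (λ f → eval F f r) (M≡prodXminus n₂ γ₂ τ₂) ⟨
      eval F (M F q ζ n₂ γ₂ τ₂) r
        ≈⟨ eval-cong r M₁≈M₂ ⟨
      eval F (M F q ζ n₁ γ₁ τ₁) r
        ≡⟨ ≡.cong (λ f → eval F f r) (M≡prodXminus n₁ γ₁ τ₁) ⟩
      eval F (prodXminus (conjugate n₁ γ₁) τ₁) r
        ≈⟨ prodXminus-root (conjugate n₁ γ₁) τ₁ (proj₁ size₁) ⟩
      0#
        ∎
      where
      open SetoidReasoning setoid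
      r = conjugate n₁ γ₁ 0

    conjugate-match : ∀ m₁ β₁ m₂ β₂ .{{_ : NonZero m₁}} →
      IsPrimitiveForm n₁ γ₁ m₁ β₁ → IsPrimitiveForm n₂ γ₂ m₂ β₂ →
      ∀ j → conjugate n₁ γ₁ 0 ≈ conjugate n₂ γ₂ j →
      m₁ ≡ m₂ × β₁ % m₁ ≡ (β₂ ℕ.* q ℕ.^ j) % m₁
    conjugate-match m₁ β₁ m₂ β₂ pf₁ pf₂ j conj₁≈conj₂ =
      proj₁ match , ≡.trans (≡.cong (_% m₁) (≡.sym (ℕ.*-identityʳ β₁))) (proj₂ match)
      where
      module P₁ = PrimitiveForm m₁ β₁ pf₁
      module P₂ = PrimitiveForm m₂ β₂ pf₂
      instance _ = P₂.nonZero
      m₁⊥q = P₁.coprimeTo n₁⊥q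
      m₂⊥q = P₂.coprimeTo n₂⊥q
      match = ζ-unitPower-injective m₁⊥q m₂⊥q (P₁.coprime-*q^ m₁⊥q 0) (P₂.coprime-*q^ m₂⊥q j)
        (trans (sym (conjugate-primitiveForm n₁⊥q m₁ β₁ pf₁ 0))
               (trans conj₁≈conj₂ (conjugate-primitiveForm n₂⊥q m₂ β₂ pf₂ j)))

    M≈M⇒conjugate-match : IsField F → M F q ζ n₁ γ₁ τ₁ ≈ₚ M F q ζ n₂ γ₂ τ₂ →
      ∀ m₁ β₁ m₂ β₂ .{{_ : NonZero m₁}} →
      IsPrimitiveForm n₁ γ₁ m₁ β₁ → IsPrimitiveForm n₂ γ₂ m₂ β₂ →
      ∃[ j ] (m₁ ≡ m₂ × β₁ % m₁ ≡ (β₂ ℕ.* q ℕ.^ j) % m₁)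
    M≈M⇒conjugate-match isField M₁≈M₂ m₁ β₁ m₂ β₂ pf₁ pf₂ =
      Product.map₂ proj₂ (decidable-stable (anyUpTo? match? τ₂) ¬¬match)
      where
      -- In a field we only learn that ζ_{n₁}^γ₁ is not different from every root of M₂;
      -- matching is decidable, so a bounded search over j < τ₂ yields the witness.
      match? : ∀ j → Dec (m₁ ≡ m₂ × β₁ % m₁ ≡ (β₂ ℕ.* q ℕ.^ j) % m₁)
      match? j = (m₁ ≟ m₂) ×-dec (β₁ % m₁ ≟ (β₂ ℕ.* q ℕ.^ j) % m₁)
      ¬¬match : ¬ ¬ (∃[ j ] (j < τ₂ × m₁ ≡ m₂ × β₁ % m₁ ≡ (β₂ ℕ.* q ℕ.^ j) % m₁))
      ¬¬match none = prodXminus-nonroot isField (conjugate n₂ γ₂) τ₂ (conjugate n₁ γ₁ 0)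
        (λ j j<τ₂ conj₁≈conj₂ →
          none (j , j<τ₂ , conjugate-match m₁ β₁ m₂ β₂ pf₁ pf₂ j conj₁≈conj₂))
        (M≈M⇒root M₁≈M₂)

    M≈M⇒samePrimitiveForm : IsField F → M F q ζ n₁ γ₁ τ₁ ≈ₚ M F q ζ n₂ γ₂ τ₂ →
      SamePrimitiveForm q n₁ γ₁ n₂ γ₂
    M≈M⇒samePrimitiveForm isField M₁≈M₂ with primitiveForm n₁ γ₁ | primitiveForm n₂ γ₂
    ... | m₁ , β₁ , pf₁ | m₂ , β₂ , pf₂ =
      fromMatch (M≈M⇒conjugate-match isField M₁≈M₂ m₁ β₁ m₂ β₂ pf₁ pf₂)
      where
      instance _ = PrimitiveForm.nonZero m₁ β₁ pf₁
      fromMatch : ∃[ j ] (m₁ ≡ m₂ × β₁ % m₁ ≡ (β₂ ℕ.* q ℕ.^ j) % m₁) →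
        SamePrimitiveForm q n₁ γ₁ n₂ γ₂
      fromMatch (j , m₁≡m₂ , β₁≡β₂qʲ) =
        m₁ , β₁ , β₂ , pf₁ ,
        ≡.subst (λ m → IsPrimitiveForm n₂ γ₂ m β₂) (≡.sym m₁≡m₂) pf₂ ,
        InCoset-⇔ {β₂ = β₂} {j = j} (proj₁ size₁) qᵗ≡1 β₁≡β₂qʲ
        where
        qᵗ≡1 = Equivalence.to (PrimitiveForm.cosetCondition m₁ β₁ pf₁ τ₁) (proj₁ (proj₂ size₁))

primePower-nonZero : ∀ {q} → IsPrimePower q → NonZero q
primePower-nonZero (p , k , p-prime , _ , q≡pᵏ) =
  ≡.subst NonZero (≡.sym q≡pᵏ) (m^n≢0 p k {{prime⇒nonZero p-prime}})

lemma5p1 : (q : ℕ) → IsPrimePower q →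
    ∀ {c ℓ} (F : CommutativeRing c ℓ) → IsAlgebraicClosureOfFq F q →
    (ζ : ℕ → CommutativeRing.Carrier F) → IsCompatibleFamily F q ζ →
    (n₁ n₂ : ℕ) → 1 ≤ n₁ → 1 ≤ n₂ → Coprime n₁ q → Coprime n₂ q →
    (γ₁ γ₂ : ℕ) → γ₁ < n₁ → γ₂ < n₂ →
    (τ₁ τ₂ : ℕ) → IsCosetSize n₁ q γ₁ τ₁ → IsCosetSize n₂ q γ₂ τ₂ →
    (PolyEq F (M F q ζ n₁ γ₁ τ₁) (M F q ζ n₂ γ₂ τ₂)
      ⇔ SamePrimitiveForm q n₁ γ₁ n₂ γ₂)
lemma5p1 q q-primePower F (isField , _) ζ compatible
         n₁ n₂ 1≤n₁ 1≤n₂ n₁⊥q n₂⊥q γ₁ γ₂ _ _ τ₁ τ₂ size₁ size₂ =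
  mk⇔ (M≈M⇒samePrimitiveForm n₁⊥q n₂⊥q size₁ size₂ isField)
      (samePrimitiveForm⇒M≈M n₁⊥q n₂⊥q size₁ size₂)
  where
  instance
    _ = primePower-nonZero q-primePower
    _ = >-nonZero 1≤n₁
    _ = >-nonZero 1≤n₂
  open MinimalPolynomials F q ζ compatible
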